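{- Let $\mathbf{k}$ be a commutative ring, let $\beta,\alpha\in\mathbf{k}$, and let $n$ be a positive integer. Let $\mathcal{X}=\mathbf{k}[x_{i,j}\mid 1\le i<j\le n]$ and let $\mathcal{J}\subseteq\mathcal{X}$ be the ideal generated by all elements $x_{i,j}x_{j,k}-x_{i,k}(x_{i,j}+x_{j,k}+\beta)-\alpha$ with $1\le i<j<k\le n$. Let $D\colon\mathcal{X}\to\mathbf{k}[t_1,\dots,t_{n-1}]$ be the $\mathbf{k}$-algebra homomorphism with $D(x_{i,j})=t_i$ for all $1\le i<j\le n$. Let $p\in\mathcal{X}$. Then for any pathless polynomial $q\in\mathcal{X}$ with $p\equiv q \bmod \mathcal{J}$, the value $D(q)$ does not depend on the choice of $q$ (it depends only on $\alpha$, $\beta$ and $p$). That is, if $q_1,q_2\in\mathcal{X}$ are pathless and $q_1\equiv p\equiv q_2\bmod\mathcal{J}$, then $D(q_1)=D(q_2)$.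
   Context: Monomials are elements of the free abelian monoid on the indeterminates (no coefficients). A monomial $\mathfrak{m}$ in the $x_{i,j}$ is pathless if there is no triple $(i,j,k)$ with $1\le i<j<k\le n$ such that $x_{i,j}x_{j,k}$ divides $\mathfrak{m}$. A polynomial in $\mathcal{X}$ is pathless if it is a $\mathbf{k}$-linear combination of pathless monomials. -}

module Defs where

open import Level using (Level; _⊔_)
open import Algebra.Bundles using (CommutativeRing)
open import Data.Nat as ℕ using (ℕ; suc)
open import Data.Nat.Properties using (<-≤-trans; <-trans)
open import Data.Fin as F using (Fin; toℕ; fromℕ<)
open import Data.Fin.Properties using (toℕ≤pred[n])
open import Data.List using (List; []; _∷_; foldr; map)
open import Data.List.Membership.Propositional using (_∈_)
open import Data.List.Relation.Unary.All using (All)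
open import Data.Product using (_×_; _,_; Σ; ∃; proj₁; proj₂)
open import Relation.Binary.PropositionalEquality using (_≡_; _≢_)

-- The polynomial ring k[V] as the free commutative k-algebra on V:
-- formal expressions modulo the congruence generated by the commutative
-- ring axioms and the requirement that constants form a ring
-- homomorphism k → k[V].

module Poly {c ℓ} (R : CommutativeRing c ℓ) (V : Set) where
  open CommutativeRing R using (0#; 1#; _+_; _*_) renaming (Carrier to K; _≈_ to _≈ₖ_)

  infixl 6 _⊕_ _⊖_
  infixl 7 _⊗_

  data Expr : Set c where
    con  : K → Expr
    var  : V → Expr
    _⊕_  : Expr → Expr → Expr
    _⊗_  : Expr → Expr → Expr
    neg  : Expr → Expr

  𝟘 𝟙 : Expr
  𝟘 = con 0#
  𝟙 = con 1#

  _⊖_ : Expr → Expr → Expr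
  p ⊖ q = p ⊕ neg q

  infix 4 _≈_
  data _≈_ : Expr → Expr → Set (c ⊔ ℓ) where
    ≈-refl  : ∀ {p} → p ≈ p
    ≈-sym   : ∀ {p q} → p ≈ q → q ≈ p
    ≈-trans : ∀ {p q r} → p ≈ q → q ≈ r → p ≈ r
    ⊕-cong  : ∀ {p p' q q'} → p ≈ p' → q ≈ q' → p ⊕ q ≈ p' ⊕ q'
    ⊗-cong  : ∀ {p p' q q'} → p ≈ p' → q ≈ q' → p ⊗ q ≈ p' ⊗ q'
    neg-cong : ∀ {p q} → p ≈ q → neg p ≈ neg q
    ⊕-assoc : ∀ p q r → (p ⊕ q) ⊕ r ≈ p ⊕ (q ⊕ r)
    ⊕-comm  : ∀ p q → p ⊕ q ≈ q ⊕ p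
    ⊕-idˡ   : ∀ p → 𝟘 ⊕ p ≈ p
    neg-invˡ : ∀ p → neg p ⊕ p ≈ 𝟘
    ⊗-assoc : ∀ p q r → (p ⊗ q) ⊗ r ≈ p ⊗ (q ⊗ r)
    ⊗-comm  : ∀ p q → p ⊗ q ≈ q ⊗ p
    ⊗-idˡ   : ∀ p → 𝟙 ⊗ p ≈ p
    distribʳ : ∀ p q r → (q ⊕ r) ⊗ p ≈ (q ⊗ p) ⊕ (r ⊗ p)
    con-cong : ∀ {a b} → a ≈ₖ b → con a ≈ con b
    con-+   : ∀ a b → con (a + b) ≈ con a ⊕ con b
    con-*   : ∀ a b → con (a * b) ≈ con a ⊗ con b

  Σ⊕ : List Expr → Expr
  Σ⊕ = foldr _⊕_ 𝟘

  Π⊗ : List Expr → Expr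
  Π⊗ = foldr _⊗_ 𝟙

  Monomial : Set
  Monomial = List V

  mono : Monomial → Expr
  mono m = Π⊗ (map var m)

  lincomb : List (K × Monomial) → Expr
  lincomb ts = Σ⊕ (map (λ t → con (proj₁ t) ⊗ mono (proj₂ t)) ts)

module _ {c ℓ} (R : CommutativeRing c ℓ) {V W : Set} where
  private
    module PV = Poly R V
    module PW = Poly R W
  subst : (V → PW.Expr) → PV.Expr → PW.Expr
  subst σ (PV.con a) = PW.con a
  subst σ (PV.var v) = σ v
  subst σ (p PV.⊕ q) = subst σ p PW.⊕ subst σ q
  subst σ (p PV.⊗ q) = subst σ p PW.⊗ subst σ q
  subst σ (PV.neg p) = PW.neg (subst σ p)

-- The specific setting: variables x_{i,j}, 1 ≤ i < j ≤ n (0-indexed Fin n)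

record XVar (n : ℕ) : Set where
  constructor x[_,_]⟨_⟩
  field
    i : Fin n
    j : Fin n
    i<j : toℕ i ℕ.< toℕ j

record Triple (n : ℕ) : Set where
  constructor ⟨_,_,_⟩⟨_,_⟩
  field
    i : Fin n
    j : Fin n
    k : Fin n
    i<j : toℕ i ℕ.< toℕ j
    j<k : toℕ j ℕ.< toℕ k

module Setting {c ℓ} (R : CommutativeRing c ℓ) (α β : CommutativeRing.Carrier R) (n : ℕ) where
  module X = Poly R (XVar n)
  open X

  PathlessMono : Monomial → Set
  PathlessMono m = ∀ u w → u ∈ m → w ∈ m → XVar.j u ≢ XVar.i w

  Pathless : Expr → Set (c ⊔ ℓ)
  Pathless q = Σ (List (CommutativeRing.Carrier R × Monomial)) λ ts →
                 All (λ t → PathlessMono (proj₂ t)) ts × (q ≈ lincomb ts)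

  gen : Triple n → Expr
  gen ⟨ i , j , k ⟩⟨ p , q ⟩ =
    (xij ⊗ xjk) ⊖ (xik ⊗ (xij ⊕ xjk ⊕ con β)) ⊖ con α
    where
      xij = var x[ i , j ]⟨ p ⟩
      xjk = var x[ j , k ]⟨ q ⟩
      xik = var x[ i , k ]⟨ <-trans p q ⟩

  InJ : Expr → Set (c ⊔ ℓ)
  InJ f = Σ (List (Expr × Triple n)) λ hs →
            f ≈ Σ⊕ (map (λ h → proj₁ h ⊗ gen (proj₂ h)) hs)

  _≡J_ : Expr → Expr → Set (c ⊔ ℓ)
  p ≡J q = InJ (p ⊖ q)

-- D : k[x_{ij}] → k[t_1, …, t_{n-1}], x_{i,j} ↦ t_i  (here n = suc m)

tIndex : ∀ {m} → XVar (suc m) → Fin m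
tIndex x[ i , j ]⟨ p ⟩ = fromℕ< (<-≤-trans p (toℕ≤pred[n] j))

D : ∀ {c ℓ} (R : CommutativeRing c ℓ) (m : ℕ) →
    Poly.Expr R (XVar (suc m)) → Poly.Expr R (Fin m)
D R m = subst R (λ v → Poly.var {R = R} (tIndex v))

-- Send x_{i,j} to s_i + φ(s_i)/(s_j - s_i) for j < n and to s_i for j = n, where
-- φ(s) = s² + βs + α and s_i = z_i⁻¹ in the iterated Laurent series ring
-- k[t_1, …, t_{n-1}]((z_1))…((z_{n-1})), the inverses 1/(s_j - s_i) being geometric series
-- in z_j. Every generator of J is sent to 0, so this ring homomorphism Ψ is constant on
-- classes mod J. Let π be the additive map that, for z_{n-1}, …, z_1 in turn, substitutes
-- t_i for z_i⁻¹ and discards the positive powers of z_i. For a pathless monomial 𝔪 we have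
-- π(Ψ(𝔪)) = D(𝔪): at the step for z_i, if 𝔪 has a factor x_{i,j} then it has no factor
-- x_{h,i}, so Ψ(𝔪) is a power of z_i⁻¹ times a series free of z_i; otherwise Ψ(𝔪) is a
-- power series in z_i and only its constant term survives.
-- Hence D(q₁) = π(Ψ(q₁)) = π(Ψ(q₂)) = D(q₂).

module Submission where

open import Defs
open import Level using (_⊔_)
open import Function using (_$_; _∘_; id)
open import Data.Empty using (⊥-elim)
open import Data.Product using (Σ; _×_; _,_; proj₁; proj₂)
open import Data.Sum using (inj₁; inj₂)
open import Data.Nat as ℕ using (ℕ; zero; suc)
import Data.Nat.Properties as ℕ
open import Data.Nat.Tactic.RingSolver using (solve-∀)
open import Data.Fin using (Fin; toℕ; fromℕ<)
open import Data.Fin.Properties using (toℕ<n; toℕ-injective)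
open import Data.List using (List; []; _∷_; map; filter; length)
open import Data.List.Properties using (filter-accept; filter-reject)
open import Data.List.Membership.Propositional using (_∈_; find; lose)
open import Data.List.Membership.Propositional.Properties using (∈-filter⁻)
open import Data.List.Relation.Binary.Subset.Propositional.Properties using (filter-⊆)
open import Data.List.Relation.Unary.Any using (here; there; any?)
open import Data.List.Relation.Unary.All using (All; []; _∷_)
open import Relation.Nullary using (yes; no; ¬_; ¬?)
open import Relation.Unary using (Decidable)
open import Relation.Binary.Core using (Rel)
open import Relation.Binary.Structures using (IsEquivalence)
open import Relation.Binary.Bundles using (Setoid)
open import Relation.Binary.PropositionalEquality as ≡ using (_≡_; _≢_)
import Relation.Binary.Reasoning.Setoid
open import Algebra.Core using (Op₁; Op₂)
open import Algebra.Definitions using (Congruent₁; Congruent₂; Associative; Commutative;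
  LeftIdentity; LeftInverse; _DistributesOverʳ_)
open import Algebra.Structures using (IsCommutativeRing)
open import Algebra.Bundles using (CommutativeRing)
import Algebra.Consequences.Setoid
open import Algebra.Morphism.Bundles using (MonoidHomomorphism; RingHomomorphism)
import Algebra.Morphism.Construct.Composition as Composition
import Algebra.Morphism.Construct.Identity as Identity

record IsCommutativeRingˡ {c ℓ} {A : Set c} (_≈_ : Rel A ℓ) (_+_ _*_ : Op₂ A) (-_ : Op₁ A)
                          (0# 1# : A) : Set (c ⊔ ℓ) where
  field
    isEquivalence : IsEquivalence _≈_
    +-cong        : Congruent₂ _≈_ _+_
    *-cong        : Congruent₂ _≈_ _*_
    -‿cong        : Congruent₁ _≈_ -_
    +-assoc       : Associative _≈_ _+_
    +-comm        : Commutative _≈_ _+_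
    +-identityˡ   : LeftIdentity _≈_ 0# _+_
    -‿inverseˡ    : LeftInverse _≈_ 0# -_ _+_
    *-assoc       : Associative _≈_ _*_
    *-comm        : Commutative _≈_ _*_
    *-identityˡ   : LeftIdentity _≈_ 1# _*_
    distribʳ      : _DistributesOverʳ_ _≈_ _*_ _+_

  isCommutativeRing : IsCommutativeRing _≈_ _+_ _*_ -_ 0# 1#
  isCommutativeRing = record
    { isRing = record
      { +-isAbelianGroup = record
        { isGroup = record
          { isMonoid = record
            { isSemigroup = record
              { isMagma = record { isEquivalence = isEquivalence ; ∙-cong = +-cong }
              ; assoc = +-assoc }
            ; identity = comm∧idˡ⇒id +-comm +-identityˡ }
          ; inverse = comm∧invˡ⇒inv +-comm -‿inverseˡ
          ; ⁻¹-cong = -‿cong }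
        ; comm = +-comm }
      ; *-cong = *-cong
      ; *-assoc = *-assoc
      ; *-identity = comm∧idˡ⇒id *-comm *-identityˡ
      ; distrib = comm∧distrʳ⇒distr +-cong *-comm distribʳ }
    ; *-comm = *-comm }
    where
    setoid : Setoid c ℓ
    setoid = record { isEquivalence = isEquivalence }
    open Algebra.Consequences.Setoid setoid

module _ {a b ℓa ℓb} (A : CommutativeRing a ℓa) (B : CommutativeRing b ℓb) where
  private
    module A = CommutativeRing A
    module B = CommutativeRing B
  open import Algebra.Properties.Group B.+-group using (identityˡ-unique; inverseˡ-unique)

  -- Preservation of 0 and of negation follow from additivity.
  mkRingHomomorphism : (f : A.Carrier → B.Carrier) → (∀ {x y} → x A.≈ y → f x B.≈ f y) →
                       (∀ x y → f (x A.+ y) B.≈ f x B.+ f y) →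
                       (∀ x y → f (x A.* y) B.≈ f x B.* f y) → f A.1# B.≈ B.1# →
                       RingHomomorphism A.rawRing B.rawRing
  mkRingHomomorphism f f-cong +-homo *-homo 1-homo = record
    { ⟦_⟧ = f
    ; isRingHomomorphism = record
      { isSemiringHomomorphism = record
        { isNearSemiringHomomorphism = record
          { +-isMonoidHomomorphism = record
            { isMagmaHomomorphism = record
              { isRelHomomorphism = record { cong = f-cong } ; homo = +-homo }
            ; ε-homo = 0-homo }
          ; *-homo = *-homo }
        ; 1#-homo = 1-homo }
      ; -‿homo = λ x → inverseˡ-unique _ _
          (B.trans (B.sym (+-homo (A.- x) x)) (B.trans (f-cong (A.-‿inverseˡ x)) 0-homo)) }
    }
    where
    0-homo : f A.0# B.≈ B.0#
    0-homo = identityˡ-unique _ _ (B.trans (B.sym (+-homo A.0# A.0#)) (f-cong (A.+-identityˡ A.0#)))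

module PowerSeries {a ℓ} (A : CommutativeRing a ℓ) where
  open CommutativeRing A
  open import Algebra.Properties.Ring ring using (-0#≈0#)
  open import Algebra.Properties.CommutativeSemigroup +-commutativeSemigroup
    using () renaming (interchange to +-interchange)
  open import Relation.Binary.Reasoning.Setoid setoid

  Series : Set a
  Series = ℕ → Carrier

  infix 4 _≋_
  _≋_ : Series → Series → Set ℓ
  f ≋ g = ∀ n → f n ≈ g n

  ≋-setoid : Setoid a ℓ
  ≋-setoid = record
    { Carrier = Series
    ; _≈_ = _≋_
    ; isEquivalence = record
      { refl = λ _ → refl ; sym = λ p n → sym (p n) ; trans = λ p q n → trans (p n) (q n) }
    }

  open Setoid ≋-setoid public using () renaming (refl to ≋-refl; sym to ≋-sym; trans to ≋-trans)
  module ≋-Reasoning = Relation.Binary.Reasoning.Setoid ≋-setoid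

  constant : Carrier → Series
  constant x zero = x
  constant x (suc n) = 0#

  tail : Series → Series
  tail f n = f (suc n)

  0ₛ 1ₛ : Series
  0ₛ _ = 0#
  1ₛ = constant 1#

  infixl 6 _+ₛ_
  infixl 7 _*ₛ_ _·ₛ_
  infix 8 -ₛ_

  _+ₛ_ : Series → Series → Series
  (f +ₛ g) n = f n + g n

  -ₛ_ : Series → Series
  (-ₛ f) n = - f n

  _·ₛ_ : Carrier → Series → Series
  (x ·ₛ f) n = x * f n

  _*ₛ_ : Series → Series → Series
  (f *ₛ g) zero = f 0 * g 0
  (f *ₛ g) (suc n) = f 0 * g (suc n) + (tail f *ₛ g) n

  z^_·_ : ℕ → Series → Series
  (z^ zero · f) n = f n
  (z^ suc k · f) zero = 0#
  (z^ suc k · f) (suc n) = (z^ k · f) n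

  +ₛ-cong : ∀ {f f' g g'} → f ≋ f' → g ≋ g' → f +ₛ g ≋ f' +ₛ g'
  +ₛ-cong p q n = +-cong (p n) (q n)

  *ₛ-cong : ∀ {f f' g g'} → f ≋ f' → g ≋ g' → f *ₛ g ≋ f' *ₛ g'
  *ₛ-cong p q zero = *-cong (p 0) (q 0)
  *ₛ-cong p q (suc n) = +-cong (*-cong (p 0) (q (suc n))) (*ₛ-cong (p ∘ suc) q n)

  *ₛ-zeroˡ : ∀ {f} g → f ≋ 0ₛ → f *ₛ g ≋ 0ₛ
  *ₛ-zeroˡ g z zero = trans (*-congʳ (z 0)) (zeroˡ _)
  *ₛ-zeroˡ g z (suc n) =
    trans (+-cong (trans (*-congʳ (z 0)) (zeroˡ _)) (*ₛ-zeroˡ g (z ∘ suc) n)) (+-identityˡ 0#)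

  constant-*ₛ : ∀ x g → constant x *ₛ g ≋ x ·ₛ g
  constant-*ₛ x g zero = refl
  constant-*ₛ x g (suc n) = trans (+-congˡ (*ₛ-zeroˡ g (λ _ → refl) n)) (+-identityʳ _)

  *ₛ-distribʳ : ∀ f f' g → (f +ₛ f') *ₛ g ≋ f *ₛ g +ₛ f' *ₛ g
  *ₛ-distribʳ f f' g zero = distribʳ (g 0) (f 0) (f' 0)
  *ₛ-distribʳ f f' g (suc n) = begin
    (f 0 + f' 0) * g (suc n) + ((tail f +ₛ tail f') *ₛ g) n
      ≈⟨ +-cong (distribʳ (g (suc n)) (f 0) (f' 0)) (*ₛ-distribʳ (tail f) (tail f') g n) ⟩
    (f 0 * g (suc n) + f' 0 * g (suc n)) + ((tail f *ₛ g) n + (tail f' *ₛ g) n)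
      ≈⟨ +-interchange _ _ _ _ ⟩
    (f 0 * g (suc n) + (tail f *ₛ g) n) + (f' 0 * g (suc n) + (tail f' *ₛ g) n) ∎

  ·ₛ-*ₛ : ∀ x f g → (x ·ₛ f) *ₛ g ≋ x ·ₛ (f *ₛ g)
  ·ₛ-*ₛ x f g zero = *-assoc x (f 0) (g 0)
  ·ₛ-*ₛ x f g (suc n) = begin
    x * f 0 * g (suc n) + ((x ·ₛ tail f) *ₛ g) n
      ≈⟨ +-cong (*-assoc x (f 0) (g (suc n))) (·ₛ-*ₛ x (tail f) g n) ⟩
    x * (f 0 * g (suc n)) + x * (tail f *ₛ g) n ≈⟨ distribˡ x _ _ ⟨
    x * (f 0 * g (suc n) + (tail f *ₛ g) n) ∎

  -- Commutativity at n and at suc n are proved together: the step for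
  -- suc (suc n) uses the hypothesis at suc n twice and at n once.
  private
    *ₛ-comm-at : ∀ n → (∀ f g → (f *ₛ g) n ≈ (g *ₛ f) n)
                     × (∀ f g → (f *ₛ g) (suc n) ≈ (g *ₛ f) (suc n))
    *ₛ-comm-at zero = (λ f g → *-comm (f 0) (g 0)) , λ f g → begin
      f 0 * g 1 + f 1 * g 0 ≈⟨ +-cong (*-comm (f 0) (g 1)) (*-comm (f 1) (g 0)) ⟩
      g 1 * f 0 + g 0 * f 1 ≈⟨ +-comm _ _ ⟩
      g 0 * f 1 + g 1 * f 0 ∎
    *ₛ-comm-at (suc n) with *ₛ-comm-at n
    ... | comm-n , comm-1+n = comm-1+n , λ f g → begin
      f 0 * g (2 ℕ.+ n) + (tail f *ₛ g) (suc n)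
        ≈⟨ +-congˡ (comm-1+n (tail f) g) ⟩
      f 0 * g (2 ℕ.+ n) + (g 0 * f (2 ℕ.+ n) + (tail g *ₛ tail f) n)
        ≈⟨ +-congˡ (+-congˡ (comm-n (tail g) (tail f))) ⟩
      f 0 * g (2 ℕ.+ n) + (g 0 * f (2 ℕ.+ n) + (tail f *ₛ tail g) n)
        ≈⟨ +-assoc _ _ _ ⟨
      (f 0 * g (2 ℕ.+ n) + g 0 * f (2 ℕ.+ n)) + (tail f *ₛ tail g) n
        ≈⟨ +-congʳ (+-comm _ _) ⟩
      (g 0 * f (2 ℕ.+ n) + f 0 * g (2 ℕ.+ n)) + (tail f *ₛ tail g) n
        ≈⟨ +-assoc _ _ _ ⟩
      g 0 * f (2 ℕ.+ n) + (f 0 * g (2 ℕ.+ n) + (tail f *ₛ tail g) n)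
        ≈⟨ +-congˡ (comm-1+n (tail g) f) ⟨
      g 0 * f (2 ℕ.+ n) + (tail g *ₛ f) (suc n) ∎

  *ₛ-comm : ∀ f g → f *ₛ g ≋ g *ₛ f
  *ₛ-comm f g n = proj₁ (*ₛ-comm-at n) f g

  *ₛ-assoc : ∀ f g h → (f *ₛ g) *ₛ h ≋ f *ₛ (g *ₛ h)
  *ₛ-assoc f g h zero = *-assoc (f 0) (g 0) (h 0)
  *ₛ-assoc f g h (suc n) = begin
    f 0 * g 0 * h (suc n) + ((f 0 ·ₛ tail g +ₛ tail f *ₛ g) *ₛ h) n
      ≈⟨ +-congˡ (*ₛ-distribʳ (f 0 ·ₛ tail g) (tail f *ₛ g) h n) ⟩
    f 0 * g 0 * h (suc n) + (((f 0 ·ₛ tail g) *ₛ h) n + ((tail f *ₛ g) *ₛ h) n)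
      ≈⟨ +-cong (*-assoc _ _ _) (+-cong (·ₛ-*ₛ (f 0) (tail g) h n) (*ₛ-assoc (tail f) g h n)) ⟩
    f 0 * (g 0 * h (suc n)) + (f 0 * (tail g *ₛ h) n + (tail f *ₛ (g *ₛ h)) n)
      ≈⟨ +-assoc _ _ _ ⟨
    (f 0 * (g 0 * h (suc n)) + f 0 * (tail g *ₛ h) n) + (tail f *ₛ (g *ₛ h)) n
      ≈⟨ +-congʳ (distribˡ (f 0) _ _) ⟨
    f 0 * (g 0 * h (suc n) + (tail g *ₛ h) n) + (tail f *ₛ (g *ₛ h)) n ∎

  *ₛ-identityˡ : ∀ g → 1ₛ *ₛ g ≋ g
  *ₛ-identityˡ g n = trans (constant-*ₛ 1# g n) (*-identityˡ (g n))

  z^-cong : ∀ k {f g} → f ≋ g → z^ k · f ≋ z^ k · g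
  z^-cong zero p = p
  z^-cong (suc k) p zero = refl
  z^-cong (suc k) p (suc n) = z^-cong k p n

  z^-injective : ∀ k {f g} → z^ k · f ≋ z^ k · g → f ≋ g
  z^-injective zero p = p
  z^-injective (suc k) p = z^-injective k (p ∘ suc)

  z^-+ : ∀ j k f → z^ (j ℕ.+ k) · f ≋ z^ j · (z^ k · f)
  z^-+ zero k f = ≋-refl
  z^-+ (suc j) k f zero = refl
  z^-+ (suc j) k f (suc n) = z^-+ j k f n

  z^-≡ : ∀ {j k} f → j ≡ k → z^ j · f ≋ z^ k · f
  z^-≡ f ≡.refl = ≋-refl

  z^-+ₛ : ∀ k f g → z^ k · (f +ₛ g) ≋ z^ k · f +ₛ z^ k · g
  z^-+ₛ zero f g = ≋-refl
  z^-+ₛ (suc k) f g zero = sym (+-identityˡ 0#)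
  z^-+ₛ (suc k) f g (suc n) = z^-+ₛ k f g n

  z^--ₛ : ∀ k f → z^ k · (-ₛ f) ≋ -ₛ (z^ k · f)
  z^--ₛ zero f = ≋-refl
  z^--ₛ (suc k) f zero = sym -0#≈0#
  z^--ₛ (suc k) f (suc n) = z^--ₛ k f n

  z^-0ₛ : ∀ k → z^ k · 0ₛ ≋ 0ₛ
  z^-0ₛ zero = ≋-refl
  z^-0ₛ (suc k) zero = refl
  z^-0ₛ (suc k) (suc n) = z^-0ₛ k n

  z^-*ₛˡ : ∀ k f g → (z^ k · f) *ₛ g ≋ z^ k · (f *ₛ g)
  z^-*ₛˡ zero f g = ≋-refl
  z^-*ₛˡ (suc k) f g zero = zeroˡ (g 0)
  z^-*ₛˡ (suc k) f g (suc n) =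
    trans (+-congʳ (zeroˡ _)) (trans (+-identityˡ _) (z^-*ₛˡ k f g n))

  z^-*ₛʳ : ∀ k f g → f *ₛ (z^ k · g) ≋ z^ k · (f *ₛ g)
  z^-*ₛʳ k f g = ≋-trans (*ₛ-comm f _) (≋-trans (z^-*ₛˡ k g f) (z^-cong k (*ₛ-comm g f)))

module LaurentSeries {a ℓ} (A : CommutativeRing a ℓ) where
  open CommutativeRing A
  open PowerSeries A
  open import Algebra.Properties.Ring ring using (-0#≈0#)
  open import Algebra.Properties.Semiring.Exp semiring using (_^_)

  -- (k , f) stands for z⁻ᵏ f: a Laurent series with finitely many negative powers.
  Laurent : Set a
  Laurent = ℕ × Series

  infix 4 _≃_
  record _≃_ (x y : Laurent) : Set ℓ where
    constructor mk≃
    field un≃ : z^ proj₁ y · proj₂ x ≋ z^ proj₁ x · proj₂ y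
  open _≃_

  z^-lift : ∀ r {p q f g} → z^ p · f ≋ z^ q · g → ∀ {m n} → m ≡ r ℕ.+ p → n ≡ r ℕ.+ q →
            z^ m · f ≋ z^ n · g
  z^-lift r {p} {q} {f} {g} H {m} {n} m≡r+p n≡r+q = begin
    z^ m · f             ≈⟨ z^-≡ f m≡r+p ⟩
    z^ (r ℕ.+ p) · f     ≈⟨ z^-+ r p f ⟩
    z^ r · (z^ p · f)    ≈⟨ z^-cong r H ⟩
    z^ r · (z^ q · g)    ≈⟨ z^-+ r q g ⟨
    z^ (r ℕ.+ q) · g     ≈⟨ z^-≡ g n≡r+q ⟨
    z^ n · g             ∎
    where open ≋-Reasoning

  ≃-from : ∀ {k k' f g} → k ≡ k' → f ≋ g → (k , f) ≃ (k' , g)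
  ≃-from {k} ≡.refl p = mk≃ (z^-cong k p)

  ≃-refl : ∀ {x} → x ≃ x
  ≃-refl = mk≃ ≋-refl

  ≃-sym : ∀ {x y} → x ≃ y → y ≃ x
  ≃-sym (mk≃ H) = mk≃ (≋-sym H)

  ≃-trans : ∀ {x y z} → x ≃ y → y ≃ z → x ≃ z
  ≃-trans {k₁ , f₁} {k₂ , f₂} {k₃ , f₃} (mk≃ H₁) (mk≃ H₂) = mk≃ (z^-injective k₂ (begin
    z^ k₂ · (z^ k₃ · f₁)    ≈⟨ z^-+ k₂ k₃ f₁ ⟨
    z^ (k₂ ℕ.+ k₃) · f₁     ≈⟨ z^-lift k₃ H₁ (ℕ.+-comm k₂ k₃) ≡.refl ⟩
    z^ (k₃ ℕ.+ k₁) · f₂     ≈⟨ z^-lift k₁ H₂ (ℕ.+-comm k₃ k₁) ≡.refl ⟩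
    z^ (k₁ ℕ.+ k₂) · f₃     ≈⟨ z^-≡ f₃ (ℕ.+-comm k₁ k₂) ⟩
    z^ (k₂ ℕ.+ k₁) · f₃     ≈⟨ z^-+ k₂ k₁ f₃ ⟩
    z^ k₂ · (z^ k₁ · f₃)    ∎))
    where open ≋-Reasoning

  infixl 6 _+ₗ_
  infixl 7 _*ₗ_
  _+ₗ_ : Laurent → Laurent → Laurent
  (k , f) +ₗ (k' , g) = (k ℕ.+ k' , z^ k' · f +ₛ z^ k · g)

  _*ₗ_ : Laurent → Laurent → Laurent
  (k , f) *ₗ (k' , g) = (k ℕ.+ k' , f *ₛ g)

  -ₗ_ : Laurent → Laurent
  -ₗ (k , f) = (k , -ₛ f)

  0ₗ 1ₗ : Laurent
  0ₗ = (0 , 0ₛ)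
  1ₗ = (0 , 1ₛ)

  private
    z^-+ₛ-+ : ∀ N p q f g → z^ N · (z^ p · f +ₛ z^ q · g) ≋ z^ (N ℕ.+ p) · f +ₛ z^ (N ℕ.+ q) · g
    z^-+ₛ-+ N p q f g =
      ≋-trans (z^-+ₛ N _ _) (+ₛ-cong (≋-sym (z^-+ N p f)) (≋-sym (z^-+ N q g)))

  +ₗ-cong : ∀ {x x' y y'} → x ≃ x' → y ≃ y' → x +ₗ y ≃ x' +ₗ y'
  +ₗ-cong {k₁ , f₁} {k₁' , f₁'} {k₂ , f₂} {k₂' , f₂'} (mk≃ H₁) (mk≃ H₂) = mk≃ $
    ≋-trans (z^-+ₛ-+ (k₁' ℕ.+ k₂') k₂ k₁ f₁ f₂)
    (≋-trans (+ₛ-cong (z^-lift (k₂' ℕ.+ k₂) H₁ (e₁ k₁' k₂' k₂) (e₂ k₁ k₂ k₂'))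
                      (z^-lift (k₁' ℕ.+ k₁) H₂ (e₃ k₁' k₂' k₁) (e₄ k₁ k₂ k₁')))
    (≋-sym (z^-+ₛ-+ (k₁ ℕ.+ k₂) k₂' k₁' f₁' f₂')))
    where
    e₁ : ∀ a b c → (a ℕ.+ b) ℕ.+ c ≡ (b ℕ.+ c) ℕ.+ a
    e₁ = solve-∀
    e₂ : ∀ a b c → (a ℕ.+ b) ℕ.+ c ≡ (c ℕ.+ b) ℕ.+ a
    e₂ = solve-∀
    e₃ : ∀ a b c → (a ℕ.+ b) ℕ.+ c ≡ (a ℕ.+ c) ℕ.+ b
    e₃ = solve-∀
    e₄ : ∀ a b c → (a ℕ.+ b) ℕ.+ c ≡ (c ℕ.+ a) ℕ.+ b
    e₄ = solve-∀

  *ₗ-cong : ∀ {x x' y y'} → x ≃ x' → y ≃ y' → x *ₗ y ≃ x' *ₗ y'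
  *ₗ-cong {k₁ , f₁} {k₁' , f₁'} {k₂ , f₂} {k₂' , f₂'} (mk≃ H₁) (mk≃ H₂) = mk≃ (begin
    z^ (k₁' ℕ.+ k₂') · (f₁ *ₛ f₂)      ≈⟨ z^-+ k₁' k₂' (f₁ *ₛ f₂) ⟩
    z^ k₁' · (z^ k₂' · (f₁ *ₛ f₂))     ≈⟨ z^-cong k₁' (z^-*ₛʳ k₂' f₁ f₂) ⟨
    z^ k₁' · (f₁ *ₛ z^ k₂' · f₂)       ≈⟨ z^-*ₛˡ k₁' f₁ _ ⟨
    (z^ k₁' · f₁) *ₛ (z^ k₂' · f₂)     ≈⟨ *ₛ-cong H₁ H₂ ⟩
    (z^ k₁ · f₁') *ₛ (z^ k₂ · f₂')     ≈⟨ z^-*ₛˡ k₁ f₁' _ ⟩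
    z^ k₁ · (f₁' *ₛ z^ k₂ · f₂')       ≈⟨ z^-cong k₁ (z^-*ₛʳ k₂ f₁' f₂') ⟩
    z^ k₁ · (z^ k₂ · (f₁' *ₛ f₂'))     ≈⟨ z^-+ k₁ k₂ (f₁' *ₛ f₂') ⟨
    z^ (k₁ ℕ.+ k₂) · (f₁' *ₛ f₂')      ∎)
    where open ≋-Reasoning

  -ₗ-cong : ∀ {x y} → x ≃ y → -ₗ x ≃ -ₗ y
  -ₗ-cong {k , f} {k' , g} (mk≃ H) =
    mk≃ (≋-trans (z^--ₛ k' f) (≋-trans (λ n → -‿cong (H n)) (≋-sym (z^--ₛ k g))))

  +ₗ-assoc : ∀ x y z → (x +ₗ y) +ₗ z ≃ x +ₗ (y +ₗ z)
  +ₗ-assoc (k₁ , f₁) (k₂ , f₂) (k₃ , f₃) = ≃-from (ℕ.+-assoc k₁ k₂ k₃) (begin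
    z^ k₃ · (z^ k₂ · f₁ +ₛ z^ k₁ · f₂) +ₛ z^ (k₁ ℕ.+ k₂) · f₃
      ≈⟨ +ₛ-cong (z^-+ₛ-+ k₃ k₂ k₁ f₁ f₂) ≋-refl ⟩
    (z^ (k₃ ℕ.+ k₂) · f₁ +ₛ z^ (k₃ ℕ.+ k₁) · f₂) +ₛ z^ (k₁ ℕ.+ k₂) · f₃
      ≈⟨ (λ n → +-assoc _ _ _) ⟩
    z^ (k₃ ℕ.+ k₂) · f₁ +ₛ (z^ (k₃ ℕ.+ k₁) · f₂ +ₛ z^ (k₁ ℕ.+ k₂) · f₃)
      ≈⟨ +ₛ-cong (z^-≡ f₁ (ℕ.+-comm k₃ k₂)) (+ₛ-cong (z^-≡ f₂ (ℕ.+-comm k₃ k₁)) ≋-refl) ⟩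
    z^ (k₂ ℕ.+ k₃) · f₁ +ₛ (z^ (k₁ ℕ.+ k₃) · f₂ +ₛ z^ (k₁ ℕ.+ k₂) · f₃)
      ≈⟨ +ₛ-cong ≋-refl (z^-+ₛ-+ k₁ k₃ k₂ f₂ f₃) ⟨
    z^ (k₂ ℕ.+ k₃) · f₁ +ₛ z^ k₁ · (z^ k₃ · f₂ +ₛ z^ k₂ · f₃) ∎)
    where open ≋-Reasoning

  +ₗ-comm : ∀ x y → x +ₗ y ≃ y +ₗ x
  +ₗ-comm (k₁ , f₁) (k₂ , f₂) = ≃-from (ℕ.+-comm k₁ k₂) (λ n → +-comm _ _)

  +ₗ-identityˡ : ∀ x → 0ₗ +ₗ x ≃ x
  +ₗ-identityˡ (k , f) = ≃-from ≡.refl (λ n → trans (+-congʳ (z^-0ₛ k n)) (+-identityˡ _))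

  -ₗ-inverseˡ : ∀ x → -ₗ x +ₗ x ≃ 0ₗ
  -ₗ-inverseˡ (k , f) =
    mk≃ λ n → trans (+-congʳ (z^--ₛ k f n)) (trans (-‿inverseˡ _) (sym (z^-0ₛ (k ℕ.+ k) n)))

  *ₗ-assoc : ∀ x y z → (x *ₗ y) *ₗ z ≃ x *ₗ (y *ₗ z)
  *ₗ-assoc (k₁ , f₁) (k₂ , f₂) (k₃ , f₃) = ≃-from (ℕ.+-assoc k₁ k₂ k₃) (*ₛ-assoc f₁ f₂ f₃)

  *ₗ-comm : ∀ x y → x *ₗ y ≃ y *ₗ x
  *ₗ-comm (k₁ , f₁) (k₂ , f₂) = ≃-from (ℕ.+-comm k₁ k₂) (*ₛ-comm f₁ f₂)

  *ₗ-identityˡ : ∀ x → 1ₗ *ₗ x ≃ x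
  *ₗ-identityˡ (k , f) = ≃-from ≡.refl (*ₛ-identityˡ f)

  *ₗ-distribʳ : ∀ x y z → (y +ₗ z) *ₗ x ≃ y *ₗ x +ₗ z *ₗ x
  *ₗ-distribʳ (k , f) (k₁ , f₁) (k₂ , f₂) = mk≃ (begin
    z^ E₁ · ((z^ k₂ · f₁ +ₛ z^ k₁ · f₂) *ₛ f)
      ≈⟨ z^-cong E₁ (≋-trans (*ₛ-distribʳ _ _ f) (+ₛ-cong (z^-*ₛˡ k₂ f₁ f) (z^-*ₛˡ k₁ f₂ f))) ⟩
    z^ E₁ · (z^ k₂ · (f₁ *ₛ f) +ₛ z^ k₁ · (f₂ *ₛ f))
      ≈⟨ z^-+ₛ-+ E₁ k₂ k₁ (f₁ *ₛ f) (f₂ *ₛ f) ⟩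
    z^ (E₁ ℕ.+ k₂) · (f₁ *ₛ f) +ₛ z^ (E₁ ℕ.+ k₁) · (f₂ *ₛ f)
      ≈⟨ +ₛ-cong (z^-≡ _ (e₁ k₁ k₂ k)) (z^-≡ _ (e₂ k₁ k₂ k)) ⟩
    z^ (E₂ ℕ.+ (k₂ ℕ.+ k)) · (f₁ *ₛ f) +ₛ z^ (E₂ ℕ.+ (k₁ ℕ.+ k)) · (f₂ *ₛ f)
      ≈⟨ z^-+ₛ-+ E₂ (k₂ ℕ.+ k) (k₁ ℕ.+ k) (f₁ *ₛ f) (f₂ *ₛ f) ⟨
    z^ E₂ · (z^ (k₂ ℕ.+ k) · (f₁ *ₛ f) +ₛ z^ (k₁ ℕ.+ k) · (f₂ *ₛ f)) ∎)
    where
    open ≋-Reasoning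
    E₁ = (k₁ ℕ.+ k) ℕ.+ (k₂ ℕ.+ k)
    E₂ = (k₁ ℕ.+ k₂) ℕ.+ k
    e₁ : ∀ a b c → ((a ℕ.+ c) ℕ.+ (b ℕ.+ c)) ℕ.+ b ≡ ((a ℕ.+ b) ℕ.+ c) ℕ.+ (b ℕ.+ c)
    e₁ = solve-∀
    e₂ : ∀ a b c → ((a ℕ.+ c) ℕ.+ (b ℕ.+ c)) ℕ.+ a ≡ ((a ℕ.+ b) ℕ.+ c) ℕ.+ (a ℕ.+ c)
    e₂ = solve-∀

  laurentRing : CommutativeRing a ℓ
  laurentRing = record
    { Carrier = Laurent ; _≈_ = _≃_ ; _+_ = _+ₗ_ ; _*_ = _*ₗ_ ; -_ = -ₗ_ ; 0# = 0ₗ ; 1# = 1ₗ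
    ; isCommutativeRing = IsCommutativeRingˡ.isCommutativeRing (record
      { isEquivalence = record { refl = ≃-refl ; sym = ≃-sym ; trans = ≃-trans }
      ; +-cong = +ₗ-cong ; *-cong = *ₗ-cong ; -‿cong = -ₗ-cong
      ; +-assoc = +ₗ-assoc ; +-comm = +ₗ-comm ; +-identityˡ = +ₗ-identityˡ ; -‿inverseˡ = -ₗ-inverseˡ
      ; *-assoc = *ₗ-assoc ; *-comm = *ₗ-comm ; *-identityˡ = *ₗ-identityˡ ; distribʳ = *ₗ-distribʳ })
    }

  open CommutativeRing laurentRing public using () renaming (_-_ to _-ₗ_)

  ι : Carrier → Laurent
  ι x = (0 , constant x)

  ι-cong : ∀ {x y} → x ≈ y → ι x ≃ ι y
  ι-cong x≈y = mk≃ λ { zero → x≈y ; (suc n) → refl }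

  ι-+ : ∀ x y → ι (x + y) ≃ ι x +ₗ ι y
  ι-+ x y = mk≃ λ { zero → refl ; (suc n) → sym (+-identityˡ 0#) }

  constant-*ₛ-constant : ∀ x y → constant x *ₛ constant y ≋ constant (x * y)
  constant-*ₛ-constant x y n = trans (constant-*ₛ x (constant y) n) (lemma n)
    where
    lemma : ∀ n → x * constant y n ≈ constant (x * y) n
    lemma zero = refl
    lemma (suc n) = zeroʳ x

  ι-* : ∀ x y → ι (x * y) ≃ ι x *ₗ ι y
  ι-* x y = mk≃ (≋-sym (constant-*ₛ-constant x y))

  ι-ringHomomorphism : RingHomomorphism rawRing (CommutativeRing.rawRing laurentRing)
  ι-ringHomomorphism = mkRingHomomorphism A laurentRing ι ι-cong ι-+ ι-* ≃-refl

  z⁻¹ : Laurent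
  z⁻¹ = (1 , 1ₛ)

  -- z / (1 - x z) = Σ xʳ zʳ⁺¹, the inverse of z⁻¹ - x
  geometric : Carrier → Laurent
  geometric x = (0 , coefficients)
    where
    coefficients : Series
    coefficients zero = 0#
    coefficients (suc r) = x ^ r

  geometric-inverse : ∀ x → geometric x *ₗ (z⁻¹ -ₗ ι x) ≃ 1ₗ
  geometric-inverse x = mk≃ (≋-trans (*ₛ-comm g d) coefficients)
    where
    open import Algebra.Properties.Ring ring using (-‿distribˡ-*)
    g = proj₂ (geometric x)
    d = proj₂ (z⁻¹ -ₗ ι x)
    tail-d : tail d ≋ constant (- x)
    tail-d zero = +-identityˡ _
    tail-d (suc n) = trans (+-identityˡ _) -0#≈0#
    telescope : ∀ n → 1# * g (suc n) + (- x) * g n ≈ constant 1# n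
    telescope zero = trans (+-cong (*-identityˡ 1#) (zeroʳ _)) (+-identityʳ 1#)
    telescope (suc n) = trans (+-cong (*-identityˡ _) (sym (-‿distribˡ-* x (x ^ n)))) (-‿inverseʳ _)
    coefficients : d *ₛ g ≋ z^ 1 · 1ₛ
    coefficients zero = zeroʳ _
    coefficients (suc n) = trans
      (+-cong (*-congʳ (+-identityʳ 1#)) (trans (*ₛ-cong tail-d ≋-refl n) (constant-*ₛ (- x) g n)))
      (telescope n)

  HasConstantTerm : Laurent → Carrier → Set (a ⊔ ℓ)
  HasConstantTerm x c = Σ Series λ F → x ≃ (0 , F) × F 0 ≈ c

  ι-hasConstantTerm : ∀ c → HasConstantTerm (ι c) c
  ι-hasConstantTerm c = constant c , ≃-refl , refl

  geometric-hasConstantTerm : ∀ x → HasConstantTerm (geometric x) 0#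
  geometric-hasConstantTerm x = proj₂ (geometric x) , ≃-refl , refl

  +ₗ-hasConstantTerm : ∀ {x y c d} → HasConstantTerm x c → HasConstantTerm y d →
                       HasConstantTerm (x +ₗ y) (c + d)
  +ₗ-hasConstantTerm (F , x≃F , F₀) (G , y≃G , G₀) = F +ₛ G , +ₗ-cong x≃F y≃G , +-cong F₀ G₀

  *ₗ-hasConstantTerm : ∀ {x y c d} → HasConstantTerm x c → HasConstantTerm y d →
                       HasConstantTerm (x *ₗ y) (c * d)
  *ₗ-hasConstantTerm (F , x≃F , F₀) (G , y≃G , G₀) = F *ₛ G , *ₗ-cong x≃F y≃G , *-cong F₀ G₀

  hasConstantTerm-resp : ∀ {x y c d} → x ≃ y → c ≈ d → HasConstantTerm x c → HasConstantTerm y d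
  hasConstantTerm-resp x≃y c≈d (F , x≃F , F₀) = F , ≃-trans (≃-sym x≃y) x≃F , trans F₀ c≈d

  infix 8 _·z⁻^_
  _·z⁻^_ : Carrier → ℕ → Laurent
  b ·z⁻^ e = (e , constant b)

  z⁻¹-*ₗ-·z⁻^ : ∀ b e → z⁻¹ *ₗ (b ·z⁻^ e) ≃ b ·z⁻^ suc e
  z⁻¹-*ₗ-·z⁻^ b e = ≃-from ≡.refl (≋-trans (constant-*ₛ-constant 1# b) (un≃ (ι-cong (*-identityˡ b))))

  ι-*ₗ-·z⁻^ : ∀ c b e → ι c *ₗ (b ·z⁻^ e) ≃ (c * b) ·z⁻^ e
  ι-*ₗ-·z⁻^ c b e = ≃-from ≡.refl (constant-*ₛ-constant c b)

module PrincipalPart {a ℓ t ℓt} (A : CommutativeRing a ℓ) (T : CommutativeRing t ℓt)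
         (π : MonoidHomomorphism (CommutativeRing.+-rawMonoid A) (CommutativeRing.+-rawMonoid T))
         (τ : CommutativeRing.Carrier T) where
  open PowerSeries A
  open LaurentSeries A
  private module A = CommutativeRing A
  open CommutativeRing T
  open MonoidHomomorphism π
  open import Algebra.Properties.Semiring.Exp semiring using (_^_)
  open import Algebra.Properties.CommutativeSemigroup +-commutativeSemigroup
    using () renaming (interchange to +-interchange)
  open import Relation.Binary.Reasoning.Setoid setoid

  truncatedSum : Series → ℕ → Carrier
  truncatedSum f zero = ⟦ f 0 ⟧
  truncatedSum f (suc k) = ⟦ f 0 ⟧ * τ ^ suc k + truncatedSum (tail f) k

  -- principalPart (Σ aᵣ zʳ) = Σ_{r ≤ 0} ⟦ aᵣ ⟧ τ⁻ʳ
  principalPart : Laurent → Carrier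
  principalPart (k , f) = truncatedSum f k

  truncatedSum-cong : ∀ {f g} k → f ≋ g → truncatedSum f k ≈ truncatedSum g k
  truncatedSum-cong zero f≋g = ⟦⟧-cong (f≋g 0)
  truncatedSum-cong (suc k) f≋g = +-cong (*-congʳ (⟦⟧-cong (f≋g 0))) (truncatedSum-cong k (f≋g ∘ suc))

  truncatedSum-+ₛ : ∀ f g k → truncatedSum (f +ₛ g) k ≈ truncatedSum f k + truncatedSum g k
  truncatedSum-+ₛ f g zero = homo _ _
  truncatedSum-+ₛ f g (suc k) = begin
    ⟦ f 0 A.+ g 0 ⟧ * τ ^ suc k + truncatedSum (tail f +ₛ tail g) k
      ≈⟨ +-cong (trans (*-congʳ (homo _ _)) (distribʳ _ _ _)) (truncatedSum-+ₛ (tail f) (tail g) k) ⟩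
    (⟦ f 0 ⟧ * τ ^ suc k + ⟦ g 0 ⟧ * τ ^ suc k) + (truncatedSum (tail f) k + truncatedSum (tail g) k)
      ≈⟨ +-interchange _ _ _ _ ⟩
    (⟦ f 0 ⟧ * τ ^ suc k + truncatedSum (tail f) k) + (⟦ g 0 ⟧ * τ ^ suc k + truncatedSum (tail g) k) ∎

  truncatedSum-0ₛ : ∀ k → truncatedSum 0ₛ k ≈ 0#
  truncatedSum-0ₛ zero = ε-homo
  truncatedSum-0ₛ (suc k) =
    trans (+-cong (trans (*-congʳ ε-homo) (zeroˡ _)) (truncatedSum-0ₛ k)) (+-identityˡ 0#)

  truncatedSum-z^ : ∀ j f k → truncatedSum (z^ j · f) (j ℕ.+ k) ≈ truncatedSum f k
  truncatedSum-z^ zero f k = refl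
  truncatedSum-z^ (suc j) f k =
    trans (+-congʳ (trans (*-congʳ ε-homo) (zeroˡ _))) (trans (+-identityˡ _) (truncatedSum-z^ j f k))

  truncatedSum-z^′ : ∀ j f k → truncatedSum (z^ j · f) (k ℕ.+ j) ≈ truncatedSum f k
  truncatedSum-z^′ j f k rewrite ℕ.+-comm k j = truncatedSum-z^ j f k

  principalPart-cong : ∀ {x y} → x ≃ y → principalPart x ≈ principalPart y
  principalPart-cong {k , f} {k' , g} (mk≃ H) = begin
    truncatedSum f k                      ≈⟨ truncatedSum-z^ k' f k ⟨
    truncatedSum (z^ k' · f) (k' ℕ.+ k)   ≈⟨ truncatedSum-cong (k' ℕ.+ k) H ⟩
    truncatedSum (z^ k · g) (k' ℕ.+ k)    ≈⟨ truncatedSum-z^′ k g k' ⟩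
    truncatedSum g k'                     ∎

  principalPart-+ : ∀ x y → principalPart (x +ₗ y) ≈ principalPart x + principalPart y
  principalPart-+ (k , f) (k' , g) =
    trans (truncatedSum-+ₛ _ _ (k ℕ.+ k')) (+-cong (truncatedSum-z^′ k' f k) (truncatedSum-z^ k g k'))

  principalPart-monoidHomomorphism :
    MonoidHomomorphism (CommutativeRing.+-rawMonoid laurentRing) +-rawMonoid
  principalPart-monoidHomomorphism = record
    { ⟦_⟧ = principalPart
    ; isMonoidHomomorphism = record
      { isMagmaHomomorphism = record
        { isRelHomomorphism = record { cong = principalPart-cong } ; homo = principalPart-+ }
      ; ε-homo = ε-homo }
    }

  principalPart-hasConstantTerm : ∀ {x c} → HasConstantTerm x c → principalPart x ≈ ⟦ c ⟧
  principalPart-hasConstantTerm (F , x≃F , F₀) = trans (principalPart-cong x≃F) (⟦⟧-cong F₀)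

  principalPart-·z⁻^ : ∀ b e → principalPart (b ·z⁻^ e) ≈ ⟦ b ⟧ * τ ^ e
  principalPart-·z⁻^ b zero = sym (*-identityʳ _)
  principalPart-·z⁻^ b (suc e) = trans (+-congˡ (truncatedSum-0ₛ e)) (+-identityʳ _)

  principalPart-ι-*ₗ : ∀ c d → (∀ x → ⟦ c A.* x ⟧ ≈ d * ⟦ x ⟧) →
                       ∀ y → principalPart (ι c *ₗ y) ≈ d * principalPart y
  principalPart-ι-*ₗ c d ⟦c*⟧ (k , f) = trans (truncatedSum-cong k (constant-*ₛ c f)) (scaled k f)
    where
    scaled : ∀ k f → truncatedSum (c ·ₛ f) k ≈ d * truncatedSum f k
    scaled zero f = ⟦c*⟧ (f 0)
    scaled (suc k) f = begin
      ⟦ c A.* f 0 ⟧ * τ ^ suc k + truncatedSum (c ·ₛ tail f) k ≈⟨ +-cong (*-congʳ (⟦c*⟧ (f 0))) (scaled k (tail f)) ⟩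
      d * ⟦ f 0 ⟧ * τ ^ suc k + d * truncatedSum (tail f) k    ≈⟨ +-congʳ (*-assoc _ _ _) ⟩
      d * (⟦ f 0 ⟧ * τ ^ suc k) + d * truncatedSum (tail f) k  ≈⟨ distribˡ d _ _ ⟨
      d * (⟦ f 0 ⟧ * τ ^ suc k + truncatedSum (tail f) k)      ∎

module GeneratorIdentity {a ℓ} (Q : CommutativeRing a ℓ) (α β : CommutativeRing.Carrier Q) where
  open CommutativeRing Q
  open import Relation.Binary.Reasoning.Setoid setoid
  open import Algebra.Solver.Ring.NaturalCoefficients.Default commutativeSemiring

  φ : Carrier → Carrier
  φ s = s * s + β * s + α

  relation : Carrier → Carrier → Carrier → Carrier
  relation x y z = x * y - z * (x + y + β) - α

  private
    a+[b-a]≈b : ∀ a b → a + (b - a) ≈ b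
    a+[b-a]≈b a b = begin
      a + (b - a)   ≈⟨ +-congˡ (+-comm b (- a)) ⟩
      a + (- a + b) ≈⟨ +-assoc a (- a) b ⟨
      (a - a) + b   ≈⟨ +-congʳ (-‿inverseʳ a) ⟩
      0# + b        ≈⟨ +-identityˡ b ⟩
      b             ∎

    relation-≈0 : ∀ x y z → x * y ≈ z * (x + y + β) + α → relation x y z ≈ 0#
    relation-≈0 x y z x*y≈ = begin
      x * y - w - α       ≈⟨ +-congʳ (+-congʳ x*y≈) ⟩
      (w + α) - w - α     ≈⟨ +-congʳ (+-congʳ (+-comm w α)) ⟩
      (α + w) - w - α     ≈⟨ +-congʳ (+-assoc α w (- w)) ⟩
      (α + (w - w)) - α   ≈⟨ +-congʳ (+-congˡ (-‿inverseʳ w)) ⟩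
      (α + 0#) - α        ≈⟨ +-congʳ (+-identityʳ α) ⟩
      α - α               ≈⟨ -‿inverseʳ α ⟩
      0#                  ∎
      where w = z * (x + y + β)

    c-a≈[b-a]+[c-b] : ∀ a b c → c - a ≈ (b - a) + (c - b)
    c-a≈[b-a]+[c-b] a b c = begin
      c - a              ≈⟨ +-congʳ (a+[b-a]≈b b c) ⟨
      (b + (c - b)) - a  ≈⟨ +-assoc b (c - b) (- a) ⟩
      b + ((c - b) - a)  ≈⟨ +-congˡ (+-comm (c - b) (- a)) ⟩
      b + (- a + (c - b)) ≈⟨ +-assoc b (- a) (c - b) ⟨
      (b - a) + (c - b)  ∎

    *-cancelʳ-invertible : ∀ {w d x y} → w * d ≈ 1# → x * d ≈ y * d → x ≈ y
    *-cancelʳ-invertible {w} {d} {x} {y} wd≈1 xd≈yd = begin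
      x                ≈⟨ *-identityʳ x ⟨
      x * 1#           ≈⟨ *-congˡ wd≈1 ⟨
      x * (w * d)      ≈⟨ solve 3 (λ x w d → x :* (w :* d) := (x :* d) :* w) refl x w d ⟩
      (x * d) * w      ≈⟨ *-congʳ xd≈yd ⟩
      (y * d) * w      ≈⟨ solve 3 (λ y w d → (y :* d) :* w := y :* (w :* d)) refl y w d ⟩
      y * (w * d)      ≈⟨ *-congˡ wd≈1 ⟩
      y * 1#           ≈⟨ *-identityʳ y ⟩
      y                ∎

    φ-cong : ∀ {s s′} → s ≈ s′ → φ s ≈ φ s′
    φ-cong s≈s′ = +-congʳ (+-cong (*-cong s≈s′ s≈s′) (*-congˡ s≈s′))

    X*d : ∀ a d u → u * d ≈ 1# → (a + φ a * u) * d ≈ a * d + φ a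
    X*d a d u u*d≈1 = begin
      (a + φ a * u) * d     ≈⟨ distribʳ d a _ ⟩
      a * d + φ a * u * d   ≈⟨ +-congˡ (*-assoc _ u d) ⟩
      a * d + φ a * (u * d) ≈⟨ +-congˡ (*-congˡ u*d≈1) ⟩
      a * d + φ a * 1#      ≈⟨ +-congˡ (*-identityʳ _) ⟩
      a * d + φ a           ∎

  relation-vanishes-∞ : ∀ a b u → u * (b - a) ≈ 1# → relation (a + φ a * u) b a ≈ 0#
  relation-vanishes-∞ a b u u*d≈1 = relation-≈0 X b a (begin
    X * b             ≈⟨ *-congˡ (a+[b-a]≈b a b) ⟨
    X * (a + d)       ≈⟨ distribˡ X a d ⟩
    X * a + X * d     ≈⟨ +-congˡ (X*d a d u u*d≈1) ⟩
    X * a + (a * d + φ a)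
      ≈⟨ solve 5 (λ X a d B A → X :* a :+ (a :* d :+ ((a :* a :+ B :* a) :+ A))
                             := a :* ((X :+ (a :+ d)) :+ B) :+ A) refl X a d β α ⟩
    a * (X + (a + d) + β) + α ≈⟨ +-congʳ (*-congˡ (+-congʳ (+-congˡ (a+[b-a]≈b a b)))) ⟩
    a * (X + b + β) + α ∎)
    where
    X = a + φ a * u
    d = b - a

  -- Clearing the denominators d₁, d₂, d₁ + d₂ of X₁, X₂, X₃ turns the relation into the
  -- polynomial identity `cleared`.
  relation-cleared : ∀ a d₁ d₂ X₁ X₂ X₃ → X₁ * d₁ ≈ a * d₁ + φ a →
                     X₂ * d₂ ≈ (a + d₁) * d₂ + φ (a + d₁) → X₃ * (d₁ + d₂) ≈ a * (d₁ + d₂) + φ a →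
                     X₁ * X₂ * (d₁ * d₂ * (d₁ + d₂)) ≈ (X₃ * (X₁ + X₂ + β) + α) * (d₁ * d₂ * (d₁ + d₂))
  relation-cleared a d₁ d₂ X₁ X₂ X₃ X₁d₁ X₂d₂ X₃d₃ = begin
    X₁ * X₂ * Δ
      ≈⟨ solve 5 (λ X₁ X₂ d₁ d₂ d₃ → X₁ :* X₂ :* (d₁ :* d₂ :* d₃) := (X₁ :* d₁) :* (X₂ :* d₂) :* d₃)
                 refl X₁ X₂ d₁ d₂ (d₁ + d₂) ⟩
    (X₁ * d₁) * (X₂ * d₂) * (d₁ + d₂)               ≈⟨ *-congʳ (*-cong X₁d₁ X₂d₂) ⟩
    N₁ * N₂ * (d₁ + d₂)                              ≈⟨ cleared ⟩
    N₃ * (N₁ * d₂ + N₂ * d₁ + β * d₁ * d₂) + α * Δ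
      ≈⟨ +-congʳ (*-cong X₃d₃ (+-congʳ (+-cong (*-congʳ X₁d₁) (*-congʳ X₂d₂)))) ⟨
    (X₃ * (d₁ + d₂)) * ((X₁ * d₁) * d₂ + (X₂ * d₂) * d₁ + β * d₁ * d₂) + α * Δ
      ≈⟨ solve 8 (λ X₁ X₂ X₃ d₁ d₂ d₃ B A → (X₃ :* (X₁ :+ X₂ :+ B) :+ A) :* (d₁ :* d₂ :* d₃)
              := (X₃ :* d₃) :* ((X₁ :* d₁) :* d₂ :+ (X₂ :* d₂) :* d₁ :+ B :* d₁ :* d₂) :+ A :* (d₁ :* d₂ :* d₃))
              refl X₁ X₂ X₃ d₁ d₂ (d₁ + d₂) β α ⟨
    (X₃ * (X₁ + X₂ + β) + α) * Δ ∎
    where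
    Δ = d₁ * d₂ * (d₁ + d₂)
    N₁ = a * d₁ + φ a
    N₂ = (a + d₁) * d₂ + φ (a + d₁)
    N₃ = a * (d₁ + d₂) + φ a
    cleared : N₁ * N₂ * (d₁ + d₂) ≈ N₃ * (N₁ * d₂ + N₂ * d₁ + β * d₁ * d₂) + α * Δ
    cleared = solve 5 (λ a d₁ d₂ B A →
      let φ = λ s → s :* s :+ B :* s :+ A
          N₁ = a :* d₁ :+ φ a
          N₂ = (a :+ d₁) :* d₂ :+ φ (a :+ d₁)
          N₃ = a :* (d₁ :+ d₂) :+ φ a
      in N₁ :* N₂ :* (d₁ :+ d₂) := N₃ :* (N₁ :* d₂ :+ N₂ :* d₁ :+ B :* d₁ :* d₂) :+ A :* (d₁ :* d₂ :* (d₁ :+ d₂)))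
      refl a d₁ d₂ β α

  relation-vanishes : ∀ a b c u₁ u₂ u₃ → u₁ * (b - a) ≈ 1# → u₂ * (c - b) ≈ 1# → u₃ * (c - a) ≈ 1# →
                      relation (a + φ a * u₁) (b + φ b * u₂) (a + φ a * u₃) ≈ 0#
  relation-vanishes a b c u₁ u₂ u₃ u₁d₁≈1 u₂d₂≈1 u₃d₃≈1 =
    relation-≈0 X₁ X₂ X₃ (*-cancelʳ-invertible uΔ≈1 (relation-cleared a d₁ d₂ X₁ X₂ X₃
      (X*d a d₁ u₁ u₁d₁≈1)
      (trans (X*d b d₂ u₂ u₂d₂≈1) (+-cong (*-congʳ b≈a+d₁) (φ-cong b≈a+d₁)))
      (X*d a (d₁ + d₂) u₃ u₃d₃≈1′)))
    where
    X₁ = a + φ a * u₁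
    X₂ = b + φ b * u₂
    X₃ = a + φ a * u₃
    d₁ = b - a
    d₂ = c - b
    b≈a+d₁ : b ≈ a + d₁
    b≈a+d₁ = sym (a+[b-a]≈b a b)
    u₃d₃≈1′ : u₃ * (d₁ + d₂) ≈ 1#
    u₃d₃≈1′ = trans (*-congˡ (sym (c-a≈[b-a]+[c-b] a b c))) u₃d₃≈1
    uΔ≈1 : (u₁ * u₂ * u₃) * (d₁ * d₂ * (d₁ + d₂)) ≈ 1#
    uΔ≈1 = begin
      (u₁ * u₂ * u₃) * (d₁ * d₂ * (d₁ + d₂))
        ≈⟨ solve 6 (λ u₁ u₂ u₃ d₁ d₂ d₃ → (u₁ :* u₂ :* u₃) :* (d₁ :* d₂ :* d₃) := (u₁ :* d₁) :* (u₂ :* d₂) :* (u₃ :* d₃))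
                   refl u₁ u₂ u₃ d₁ d₂ (d₁ + d₂) ⟩
      (u₁ * d₁) * (u₂ * d₂) * (u₃ * (d₁ + d₂)) ≈⟨ *-cong (*-cong u₁d₁≈1 u₂d₂≈1) u₃d₃≈1′ ⟩
      1# * 1# * 1#                             ≈⟨ trans (*-identityʳ _) (*-identityʳ _) ⟩
      1#                                       ∎

module PolynomialRing {c ℓ} (R : CommutativeRing c ℓ) (V : Set) where
  open Poly R V
  private module R = CommutativeRing R

  polynomialRing : CommutativeRing c (c ⊔ ℓ)
  polynomialRing = record
    { Carrier = Expr ; _≈_ = _≈_ ; _+_ = _⊕_ ; _*_ = _⊗_ ; -_ = neg ; 0# = 𝟘 ; 1# = 𝟙
    ; isCommutativeRing = IsCommutativeRingˡ.isCommutativeRing (record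
      { isEquivalence = record { refl = ≈-refl ; sym = ≈-sym ; trans = ≈-trans }
      ; +-cong = ⊕-cong ; *-cong = ⊗-cong ; -‿cong = neg-cong
      ; +-assoc = ⊕-assoc ; +-comm = ⊕-comm ; +-identityˡ = ⊕-idˡ ; -‿inverseˡ = neg-invˡ
      ; *-assoc = ⊗-assoc ; *-comm = ⊗-comm ; *-identityˡ = ⊗-idˡ ; distribʳ = distribʳ })
    }

  con-ringHomomorphism : RingHomomorphism R.rawRing (CommutativeRing.rawRing polynomialRing)
  con-ringHomomorphism = mkRingHomomorphism R polynomialRing con con-cong con-+ con-* ≈-refl

module Evaluation {c ℓ b ℓb} (R : CommutativeRing c ℓ) (V : Set) (B : CommutativeRing b ℓb)
                  (κ : RingHomomorphism (CommutativeRing.rawRing R) (CommutativeRing.rawRing B))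
                  (v : V → CommutativeRing.Carrier B) where
  open Poly R V renaming (_≈_ to _≈ₚ_)
  open CommutativeRing B
  open RingHomomorphism κ

  eval : Expr → Carrier
  eval (con x) = ⟦ x ⟧
  eval (var x) = v x
  eval (p ⊕ q) = eval p + eval q
  eval (p ⊗ q) = eval p * eval q
  eval (neg p) = - eval p

  eval-cong : ∀ {p q} → p ≈ₚ q → eval p ≈ eval q
  eval-cong ≈-refl = refl
  eval-cong (≈-sym p≈q) = sym (eval-cong p≈q)
  eval-cong (≈-trans p≈q q≈r) = trans (eval-cong p≈q) (eval-cong q≈r)
  eval-cong (⊕-cong p≈p' q≈q') = +-cong (eval-cong p≈p') (eval-cong q≈q')
  eval-cong (⊗-cong p≈p' q≈q') = *-cong (eval-cong p≈p') (eval-cong q≈q')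
  eval-cong (neg-cong p≈q) = -‿cong (eval-cong p≈q)
  eval-cong (⊕-assoc p q r) = +-assoc _ _ _
  eval-cong (⊕-comm p q) = +-comm _ _
  eval-cong (⊕-idˡ p) = trans (+-congʳ 0#-homo) (+-identityˡ _)
  eval-cong (neg-invˡ p) = trans (-‿inverseˡ _) (sym 0#-homo)
  eval-cong (⊗-assoc p q r) = *-assoc _ _ _
  eval-cong (⊗-comm p q) = *-comm _ _
  eval-cong (⊗-idˡ p) = trans (*-congʳ 1#-homo) (*-identityˡ _)
  eval-cong (distribʳ p q r) = CommutativeRing.distribʳ B _ _ _
  eval-cong (con-cong x≈y) = ⟦⟧-cong x≈y
  eval-cong (con-+ x y) = +-homo x y
  eval-cong (con-* x y) = *-homo x y

module Main {c ℓ} (R : CommutativeRing c ℓ) (α β : CommutativeRing.Carrier R) (m : ℕ) where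
  private
    module K = CommutativeRing R
    module X = Poly R (XVar (suc m))
    module Y = Poly R (Fin m)
  open PolynomialRing R (Fin m) using (con-ringHomomorphism) renaming (polynomialRing to T)
  module T = CommutativeRing T
  open import Algebra.Properties.Semiring.Exp T.semiring using (_^_)

  -- tower L = k[t₀, …, t_{m-1}]((z₀))…((z_{L-1})), indices starting at 0
  tower : ℕ → CommutativeRing c (c ⊔ ℓ)
  tower zero = T
  tower (suc L) = LaurentSeries.laurentRing (tower L)

  module S (L : ℕ) = CommutativeRing (tower L)
  module 𝕃 (L : ℕ) = LaurentSeries (tower L)

  κ : ∀ L → RingHomomorphism K.rawRing (S.rawRing L)
  κ zero = con-ringHomomorphism
  κ (suc L) = Composition.ringHomomorphism {M₁ = K.ring} {M₂ = S.ring L} {M₃ = S.ring (suc L)}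
                (κ L) (𝕃.ι-ringHomomorphism L)

  private
    toℕ≤m : (k : Fin (suc m)) → toℕ k ℕ.≤ m
    toℕ≤m k = ℕ.≤-pred (toℕ<n k)

  t : ℕ → T.Carrier
  t i with i ℕ.<? m
  ... | yes i<m = Y.var (fromℕ< i<m)
  ... | no _ = Y.𝟘

  π : ∀ L → MonoidHomomorphism (S.+-rawMonoid L) T.+-rawMonoid
  π zero = record { ⟦_⟧ = id ; isMonoidHomomorphism = Identity.isMonoidHomomorphism T.+-rawMonoid Y.≈-refl }
  π (suc L) = PrincipalPart.principalPart-monoidHomomorphism (tower L) T (π L) (t L)

  infix 9 κ[_]_ π[_]_ ι[_]_
  κ[_]_ : ∀ L → K.Carrier → S.Carrier L
  κ[ L ] a = RingHomomorphism.⟦_⟧ (κ L) a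

  π[_]_ : ∀ L → S.Carrier L → T.Carrier
  π[ L ] x = MonoidHomomorphism.⟦_⟧ (π L) x

  ι[_]_ : ∀ L → S.Carrier L → S.Carrier (suc L)
  ι[ L ] x = 𝕃.ι L x

  π-cong : ∀ L {x y} → let open S L in x ≈ y → π[ L ] x T.≈ π[ L ] y
  π-cong L = MonoidHomomorphism.⟦⟧-cong (π L)

  π-κ-* : ∀ L a y → π[ L ] (S._*_ L (κ[ L ] a) y) T.≈ Y.con a Y.⊗ π[ L ] y
  π-κ-* zero a y = Y.≈-refl
  π-κ-* (suc L) a y = principalPart-ι-*ₗ (κ[ L ] a) (Y.con a) (π-κ-* L a) y
    where open PrincipalPart (tower L) T (π L) (t L)

  π-κ-0 : ∀ L → π[ L ] (κ[ L ] K.0#) T.≈ Y.𝟘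
  π-κ-0 L = T.trans (π-cong L (RingHomomorphism.0#-homo (κ L))) (MonoidHomomorphism.ε-homo (π L))

  module ι-hom (L : ℕ) = RingHomomorphism (𝕃.ι-ringHomomorphism L)

  -- sᵢ = zᵢ⁻¹ for i < L; out of range it is junk (0)
  s : ℕ → ∀ L → S.Carrier L
  s i zero = Y.𝟘
  s i (suc L) with i ℕ.≟ L
  ... | yes _ = 𝕃.z⁻¹ L
  ... | no _ = ι[ L ] s i L

  -- uᵢⱼ = 1 / (sⱼ - sᵢ) for i < j < L, a power series in zⱼ
  u : ℕ → ℕ → ∀ L → S.Carrier L
  u i j zero = Y.𝟘
  u i j (suc L) with j ℕ.≟ L
  ... | yes _ = 𝕃.geometric L (s i L)
  ... | no _ = ι[ L ] u i j L

  φ : ∀ L → S.Carrier L → S.Carrier L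
  φ L = GeneratorIdentity.φ (tower L) (κ[ L ] α) (κ[ L ] β)

  -- the image of x_{i,j}: sᵢ + φ(sᵢ) / (sⱼ - sᵢ), read as sᵢ when j is the last index
  x̂ : ℕ → ℕ → ∀ L → S.Carrier L
  x̂ i j L with j ℕ.<? L
  ... | yes _ = let open S L in s i L + φ L (s i L) * u i j L
  ... | no _ = s i L

  s-≡ : ∀ L → s L (suc L) ≡ 𝕃.z⁻¹ L
  s-≡ L with L ℕ.≟ L
  ... | yes _ = ≡.refl
  ... | no L≢L = ⊥-elim (L≢L ≡.refl)

  s-≢ : ∀ {i L} → i ≢ L → s i (suc L) ≡ ι[ L ] s i L
  s-≢ {i} {L} i≢L with i ℕ.≟ L
  ... | yes i≡L = ⊥-elim (i≢L i≡L)
  ... | no _ = ≡.refl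

  u-≡ : ∀ i L → u i L (suc L) ≡ 𝕃.geometric L (s i L)
  u-≡ i L with L ℕ.≟ L
  ... | yes _ = ≡.refl
  ... | no L≢L = ⊥-elim (L≢L ≡.refl)

  u-≢ : ∀ i {j L} → j ≢ L → u i j (suc L) ≡ ι[ L ] u i j L
  u-≢ i {j} {L} j≢L with j ℕ.≟ L
  ... | yes j≡L = ⊥-elim (j≢L j≡L)
  ... | no _ = ≡.refl

  x̂-< : ∀ i {j L} → j ℕ.< L → let open S L in x̂ i j L ≡ s i L + φ L (s i L) * u i j L
  x̂-< i {j} {L} j<L with j ℕ.<? L
  ... | yes _ = ≡.refl
  ... | no j≮L = ⊥-elim (j≮L j<L)

  x̂-≮ : ∀ i {j L} → ¬ j ℕ.< L → x̂ i j L ≡ s i L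
  x̂-≮ i {j} {L} j≮L with j ℕ.<? L
  ... | yes j<L = ⊥-elim (j≮L j<L)
  ... | no _ = ≡.refl

  u-inverse : ∀ L {i j} → i ℕ.< j → j ℕ.< L → let open S L in u i j L * (s j L - s i L) ≈ 1#
  u-inverse (suc L) {i} {j} i<j j<1+L with ℕ.m≤n⇒m<n∨m≡n (ℕ.≤-pred j<1+L)
  ... | inj₂ ≡.refl rewrite u-≡ i j | s-≡ j | s-≢ (ℕ.<⇒≢ i<j) = 𝕃.geometric-inverse j (s i j)
  ... | inj₁ j<L rewrite u-≢ i (ℕ.<⇒≢ j<L) | s-≢ (ℕ.<⇒≢ j<L) | s-≢ (ℕ.<⇒≢ (ℕ.<-trans i<j j<L)) = begin
    ι[ L ] uᵢⱼ * (ι[ L ] sⱼ - ι[ L ] sᵢ)    ≈⟨ *-congˡ {ι[ L ] uᵢⱼ} (+-congˡ {ι[ L ] sⱼ} (ι-hom.-‿homo L sᵢ)) ⟨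
    ι[ L ] uᵢⱼ * (ι[ L ] sⱼ + ι[ L ] (S.-_ L sᵢ)) ≈⟨ *-congˡ {ι[ L ] uᵢⱼ} (ι-hom.+-homo L sⱼ _) ⟨
    ι[ L ] uᵢⱼ * ι[ L ] (S._-_ L sⱼ sᵢ)     ≈⟨ ι-hom.*-homo L uᵢⱼ _ ⟨
    ι[ L ] (S._*_ L uᵢⱼ (S._-_ L sⱼ sᵢ))    ≈⟨ ι-hom.⟦⟧-cong L (u-inverse L i<j j<L) ⟩
    ι[ L ] S.1# L                            ≈⟨ ι-hom.1#-homo L ⟩
    1#                                       ∎
    where
    open CommutativeRing (tower (suc L))
    open import Relation.Binary.Reasoning.Setoid setoid
    uᵢⱼ = u i j L
    sⱼ = s j L
    sᵢ = s i L

  source target : XVar (suc m) → ℕ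
  source v = toℕ (XVar.i v)
  target v = toℕ (XVar.j v)

  x̂ᵥ : ∀ L → XVar (suc m) → S.Carrier L
  x̂ᵥ L v = x̂ (source v) (target v) L

  open Evaluation R (XVar (suc m)) (tower m) (κ m) (x̂ᵥ m) public
    using () renaming (eval to Ψ; eval-cong to Ψ-cong)

  open GeneratorIdentity (tower m) (κ[ m ] α) (κ[ m ] β) using (relation-vanishes; relation-vanishes-∞)

  Ψ-gen : ∀ τ → let open S m in Ψ (Setting.gen R α β (suc m) τ) ≈ 0#
  Ψ-gen ⟨ i , j , k ⟩⟨ i<j , j<k ⟩ with toℕ k ℕ.<? m
  ... | yes k<m rewrite x̂-< (toℕ i) (ℕ.<-trans j<k k<m) =
    relation-vanishes (s (toℕ i) m) (s (toℕ j) m) (s (toℕ k) m) (u (toℕ i) (toℕ j) m) (u (toℕ j) (toℕ k) m)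
      (u (toℕ i) (toℕ k) m) (u-inverse m i<j (ℕ.<-trans j<k k<m)) (u-inverse m j<k k<m)
      (u-inverse m (ℕ.<-trans i<j j<k) k<m)
  ... | no k≮m rewrite x̂-< (toℕ i) (ℕ.<-≤-trans j<k (toℕ≤m k)) =
    relation-vanishes-∞ (s (toℕ i) m) (s (toℕ j) m) (u (toℕ i) (toℕ j) m)
      (u-inverse m i<j (ℕ.<-≤-trans j<k (toℕ≤m k)))

  Ψ-J : ∀ {p q} → Setting._≡J_ R α β (suc m) p q → let open S m in Ψ p ≈ Ψ q
  Ψ-J {p} {q} (hs , p-q≈Σ) = begin
    Ψ p                  ≈⟨ +-identityʳ _ ⟨
    Ψ p + 0#             ≈⟨ +-congˡ (-‿inverseˡ (Ψ q)) ⟨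
    Ψ p + (- Ψ q + Ψ q)  ≈⟨ +-assoc _ _ _ ⟨
    (Ψ p - Ψ q) + Ψ q    ≈⟨ +-congʳ (trans (Ψ-cong p-q≈Σ) (Ψ-Σ hs)) ⟩
    0# + Ψ q             ≈⟨ +-identityˡ _ ⟩
    Ψ q                  ∎
    where
    open S m
    open import Relation.Binary.Reasoning.Setoid setoid
    Ψ-Σ : ∀ hs → Ψ (X.Σ⊕ (map (λ h → proj₁ h X.⊗ Setting.gen R α β (suc m) (proj₂ h)) hs)) ≈ 0#
    Ψ-Σ [] = RingHomomorphism.0#-homo (κ m)
    Ψ-Σ ((f , τ) ∷ hs) = trans (+-cong (trans (*-congˡ (Ψ-gen τ)) (zeroʳ _)) (Ψ-Σ hs)) (+-identityˡ _)

  ι-φ : ∀ L x → let open S (suc L) in ι[ L ] (φ L x) ≈ φ (suc L) (ι[ L ] x)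
  ι-φ L x = trans (ι-hom.+-homo L _ _)
              (+-congʳ (trans (ι-hom.+-homo L _ _) (+-cong (ι-hom.*-homo L x x) (ι-hom.*-homo L _ x))))
    where open S (suc L)

  x̂-ι : ∀ {L} i j → i ℕ.< L → j ≢ L → let open S (suc L) in x̂ i j (suc L) ≈ ι[ L ] x̂ i j L
  x̂-ι {L} i j i<L j≢L with j ℕ.<? L
  ... | yes j<L rewrite x̂-< i (ℕ.m<n⇒m<1+n j<L) | s-≢ (ℕ.<⇒≢ i<L) | u-≢ i j≢L =
    sym (trans (ι-hom.+-homo L _ _) (+-congˡ (trans (ι-hom.*-homo L _ _) (*-congʳ (ι-φ L (s i L))))))
    where open S (suc L)
  ... | no j≮L rewrite x̂-≮ i (λ j<1+L → j≮L (ℕ.≤∧≢⇒< (ℕ.≤-pred j<1+L) j≢L)) | s-≢ (ℕ.<⇒≢ i<L) =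
    S.refl (suc L)

  x̂-hasConstantTerm : ∀ {L} i j → i ℕ.< L → 𝕃.HasConstantTerm L (x̂ i j (suc L)) (x̂ i j L)
  x̂-hasConstantTerm {L} i j i<L with j ℕ.≟ L
  ... | no j≢L = hasConstantTerm-resp (S.sym (suc L) (x̂-ι i j i<L j≢L)) (S.refl L) (ι-hasConstantTerm _)
    where open LaurentSeries (tower L)
  ... | yes ≡.refl rewrite x̂-< i (ℕ.n<1+n j) | s-≢ (ℕ.<⇒≢ i<L) | u-≡ i j | x̂-≮ i {j} {j} (ℕ.n≮n j) =
    hasConstantTerm-resp ≃-refl (trans (+-congˡ (zeroʳ _)) (+-identityʳ _))
      (+ₗ-hasConstantTerm (ι-hasConstantTerm sᵢ)
        (*ₗ-hasConstantTerm (hasConstantTerm-resp (ι-φ j sᵢ) refl (ι-hasConstantTerm (φ j sᵢ)))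
                            (geometric-hasConstantTerm sᵢ)))
    where
    open LaurentSeries (tower j)
    open S j
    sᵢ = s i j

  x̂-product : ∀ L → List (XVar (suc m)) → S.Carrier L
  x̂-product L [] = S.1# L
  x̂-product L (v ∷ vs) = S._*_ L (x̂ᵥ L v) (x̂-product L vs)

  t-product : List (XVar (suc m)) → T.Carrier
  t-product [] = Y.𝟙
  t-product (v ∷ vs) = t (source v) Y.⊗ t-product vs

  sourceIs? : ∀ L → Decidable (λ v → source v ≡ L)
  sourceIs? L v = source v ℕ.≟ L

  withSource withoutSource : ℕ → List (XVar (suc m)) → List (XVar (suc m))
  withSource L = filter (sourceIs? L)
  withoutSource L = filter (¬? ∘ sourceIs? L)

  x̂-product-hasConstantTerm : ∀ L vs → (∀ v → v ∈ vs → source v ℕ.< L) →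
                              𝕃.HasConstantTerm L (x̂-product (suc L) vs) (x̂-product L vs)
  x̂-product-hasConstantTerm L [] _ = 𝕃.ι-hasConstantTerm L (S.1# L)
  x̂-product-hasConstantTerm L (v ∷ vs) source<L =
    𝕃.*ₗ-hasConstantTerm L (x̂-hasConstantTerm (source v) (target v) (source<L v (here ≡.refl)))
                           (x̂-product-hasConstantTerm L vs (λ w → source<L w ∘ there))

  x̂-at-source : ∀ v → x̂ᵥ (suc (source v)) v ≡ 𝕃.z⁻¹ (source v)
  x̂-at-source v rewrite x̂-≮ (source v) (ℕ.<⇒≱ (XVar.i<j v) ∘ ℕ.≤-pred) = s-≡ (source v)

  x̂-product-polar : ∀ L vs → (∀ v → v ∈ vs → source v ℕ.< suc L) → (∀ v → v ∈ vs → target v ≢ L) →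
                    let open LaurentSeries (tower L) in
                    x̂-product (suc L) vs ≃ x̂-product L (withoutSource L vs) ·z⁻^ length (withSource L vs)
  x̂-product-polar L [] _ _ = 𝕃.≃-refl L
  x̂-product-polar L (v ∷ vs) source<1+L target≢L with sourceIs? L v
  ... | yes ≡.refl rewrite filter-accept (sourceIs? (source v)) {v} {vs} ≡.refl
                        | filter-reject (¬? ∘ sourceIs? (source v)) {v} {vs} (_$ ≡.refl)
                        | x̂-at-source v =
    ≃-trans (*-congˡ (x̂-product-polar L vs (λ w → source<1+L w ∘ there) (λ w → target≢L w ∘ there)))
            (z⁻¹-*ₗ-·z⁻^ _ _)
    where open LaurentSeries (tower (source v))
          open S (suc (source v)) using (*-congˡ)
  ... | no source≢L rewrite filter-reject (sourceIs? L) {v} {vs} source≢L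
                         | filter-accept (¬? ∘ sourceIs? L) {v} {vs} source≢L =
    ≃-trans (*-cong (x̂-ι (source v) (target v) source<L (target≢L v (here ≡.refl)))
                    (x̂-product-polar L vs (λ w → source<1+L w ∘ there) (λ w → target≢L w ∘ there)))
            (ι-*ₗ-·z⁻^ _ _ _)
    where open LaurentSeries (tower L)
          open S (suc L) using (*-cong)
          source<L = ℕ.≤∧≢⇒< (ℕ.≤-pred (source<1+L v (here ≡.refl))) source≢L

  t-product-split : ∀ L vs → t-product vs T.≈ t-product (withoutSource L vs) Y.⊗ t L ^ length (withSource L vs)
  t-product-split L [] = Y.≈-sym (T.*-identityʳ _)
  t-product-split L (v ∷ vs) with sourceIs? L v
  ... | yes ≡.refl rewrite filter-accept (sourceIs? (source v)) {v} {vs} ≡.refl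
                        | filter-reject (¬? ∘ sourceIs? (source v)) {v} {vs} (_$ ≡.refl) =
    begin
    tᵥ * t-product vs         ≈⟨ *-congˡ (t-product-split (source v) vs) ⟩
    tᵥ * (P * tᵥ ^ e)         ≈⟨ *-assoc _ _ _ ⟨
    (tᵥ * P) * tᵥ ^ e         ≈⟨ *-congʳ (*-comm _ _) ⟩
    (P * tᵥ) * tᵥ ^ e         ≈⟨ *-assoc _ _ _ ⟩
    P * (tᵥ * tᵥ ^ e)         ∎
    where
    open T
    open import Relation.Binary.Reasoning.Setoid setoid
    tᵥ = t (source v)
    P = t-product (withoutSource (source v) vs)
    e = length (withSource (source v) vs)
  ... | no source≢L rewrite filter-reject (sourceIs? L) {v} {vs} source≢L
                         | filter-accept (¬? ∘ sourceIs? L) {v} {vs} source≢L =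
    T.trans (T.*-congˡ (t-product-split L vs)) (T.sym (T.*-assoc _ _ _))

  PathlessMono : List (XVar (suc m)) → Set
  PathlessMono = Setting.PathlessMono R α β (suc m)

  π-x̂-product : ∀ L vs → (∀ v → v ∈ vs → source v ℕ.< L) → PathlessMono vs →
                π[ L ] x̂-product L vs T.≈ t-product vs
  π-x̂-product zero [] _ _ = Y.≈-refl
  π-x̂-product zero (v ∷ vs) source<0 _ = ⊥-elim (ℕ.n≮0 (source<0 v (here ≡.refl)))
  π-x̂-product (suc L) vs source<1+L pathless with any? (sourceIs? L) vs
  ... | no ¬any = T.trans (principalPart-hasConstantTerm (x̂-product-hasConstantTerm L vs source<L))
                          (π-x̂-product L vs source<L pathless)
    where
    open PrincipalPart (tower L) T (π L) (t L)
    source<L : ∀ v → v ∈ vs → source v ℕ.< L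
    source<L v v∈vs = ℕ.≤∧≢⇒< (ℕ.≤-pred (source<1+L v v∈vs)) (¬any ∘ lose v∈vs)
  ... | yes any with find any
  ...   | w , w∈vs , source≡L = begin
    π[ suc L ] x̂-product (suc L) vs                    ≈⟨ principalPart-cong (x̂-product-polar L vs source<1+L target≢L) ⟩
    π[ suc L ] (x̂-product L rest ·z⁻^ e)               ≈⟨ principalPart-·z⁻^ _ e ⟩
    π[ L ] x̂-product L rest Y.⊗ t L ^ e                ≈⟨ T.*-congʳ (π-x̂-product L rest source<L pathless-rest) ⟩
    t-product rest Y.⊗ t L ^ e                          ≈⟨ t-product-split L vs ⟨
    t-product vs                                        ∎
    where
    open PrincipalPart (tower L) T (π L) (t L)
    open LaurentSeries (tower L) using (_·z⁻^_)
    open import Relation.Binary.Reasoning.Setoid T.setoid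
    rest = withoutSource L vs
    e = length (withSource L vs)
    -- an edge ending at L, followed by the edge w starting at L, would be a path
    target≢L : ∀ v → v ∈ vs → target v ≢ L
    target≢L v v∈vs target≡L = pathless v w v∈vs w∈vs (toℕ-injective (≡.trans target≡L (≡.sym source≡L)))
    source<L : ∀ v → v ∈ rest → source v ℕ.< L
    source<L v v∈rest with ∈-filter⁻ (¬? ∘ sourceIs? L) v∈rest
    ... | v∈vs , source≢L = ℕ.≤∧≢⇒< (ℕ.≤-pred (source<1+L v v∈vs)) source≢L
    pathless-rest : PathlessMono rest
    pathless-rest v v′ v∈rest v′∈rest = pathless v v′ (rest⊆vs v∈rest) (rest⊆vs v′∈rest)
      where rest⊆vs = filter-⊆ (¬? ∘ sourceIs? L) vs

  Ψ-mono : ∀ vs → let open S m in Ψ (X.mono vs) ≈ x̂-product m vs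
  Ψ-mono [] = RingHomomorphism.1#-homo (κ m)
  Ψ-mono (v ∷ vs) = S.*-congˡ m (Ψ-mono vs)

  Dₘ : X.Expr → Y.Expr
  Dₘ = D R m

  var-tIndex : ∀ v → Y.var (tIndex v) ≡ t (source v)
  var-tIndex x[ i , j ]⟨ i<j ⟩ with toℕ i ℕ.<? m
  ... | yes _ = ≡.refl
  ... | no i≮m = ⊥-elim (i≮m (ℕ.<-≤-trans i<j (toℕ≤m j)))

  D-mono : ∀ vs → Dₘ (X.mono vs) Y.≈ t-product vs
  D-mono [] = Y.≈-refl
  D-mono (v ∷ vs) rewrite var-tIndex v = Y.⊗-cong Y.≈-refl (D-mono vs)

  D-cong : ∀ {p q} → p X.≈ q → Dₘ p Y.≈ Dₘ q
  D-cong {p} {q} p≈q = ≡.subst₂ Y._≈_ (≡.sym (D≡eval p)) (≡.sym (D≡eval q)) (eval-cong p≈q)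
    where
    open Evaluation R (XVar (suc m)) T con-ringHomomorphism (Y.var ∘ tIndex)
    D≡eval : ∀ p → Dₘ p ≡ eval p
    D≡eval (X.con a) = ≡.refl
    D≡eval (X.var v) = ≡.refl
    D≡eval (p X.⊕ q) = ≡.cong₂ Y._⊕_ (D≡eval p) (D≡eval q)
    D≡eval (p X.⊗ q) = ≡.cong₂ Y._⊗_ (D≡eval p) (D≡eval q)
    D≡eval (X.neg p) = ≡.cong Y.neg (D≡eval p)

  π-Ψ-mono : ∀ vs → PathlessMono vs → π[ m ] Ψ (X.mono vs) T.≈ Dₘ (X.mono vs)
  π-Ψ-mono vs pathless =
    T.trans (π-cong m (Ψ-mono vs)) (T.trans (π-x̂-product m vs source<m pathless) (T.sym (D-mono vs)))
    where
    source<m : ∀ v → v ∈ vs → source v ℕ.< m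
    source<m x[ i , j ]⟨ i<j ⟩ _ = ℕ.<-≤-trans i<j (toℕ≤m j)

  π-Ψ-pathless : ∀ {q} → Setting.Pathless R α β (suc m) q → π[ m ] Ψ q T.≈ Dₘ q
  π-Ψ-pathless {q} (ts , pathless , q≈Σ) =
    T.trans (π-cong m (Ψ-cong q≈Σ)) (T.trans (lincomb ts pathless) (D-cong (X.≈-sym q≈Σ)))
    where
    lincomb : ∀ ts → All (PathlessMono ∘ proj₂) ts → π[ m ] Ψ (X.lincomb ts) T.≈ Dₘ (X.lincomb ts)
    lincomb [] [] = π-κ-0 m
    lincomb ((a , vs) ∷ ts) (pathless-vs ∷ pathless-ts) =
      T.trans (MonoidHomomorphism.homo (π m) _ _)
        (Y.⊕-cong (T.trans (π-κ-* m a _) (Y.⊗-cong Y.≈-refl (π-Ψ-mono vs pathless-vs)))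
                  (lincomb ts pathless-ts))

theorem2p7 : ∀ {c ℓ} (R : CommutativeRing c ℓ) (α β : CommutativeRing.Carrier R) (m : ℕ)
               (p q₁ q₂ : Poly.Expr R (XVar (suc m))) →
               Setting.Pathless R α β (suc m) q₁ →
               Setting.Pathless R α β (suc m) q₂ →
               Setting._≡J_ R α β (suc m) q₁ p →
               Setting._≡J_ R α β (suc m) p q₂ →
               Poly._≈_ R (Fin m) (D R m q₁) (D R m q₂)
theorem2p7 R α β m p q₁ q₂ pathless₁ pathless₂ q₁≡p p≡q₂ = begin
  D R m q₁     ≈⟨ π-Ψ-pathless pathless₁ ⟨
  π[ m ] Ψ q₁  ≈⟨ π-cong m (S.trans m (Ψ-J q₁≡p) (Ψ-J p≡q₂)) ⟩
  π[ m ] Ψ q₂  ≈⟨ π-Ψ-pathless pathless₂ ⟩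
  D R m q₂     ∎
  where
  open Main R α β m
  open import Relation.Binary.Reasoning.Setoid T.setoid
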